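{- Let $k=2a$ with $a>1$ odd, and define $f:\{0,1,\ldots,k-1\}\to\{ -1,1\}$ by $f(j)=-1$ if $j\bmod a<\frac{a-1}{2}$ and $f(j)=1$ if $j\bmod a\ge\frac{a-1}{2}$ (where $j\bmod a\in\{0,\ldots,a-1\}$). Then: (1) the number of $j$ with $f(j)=1$ is $\frac k2+1$ and the number with $f(j)=-1$ is $\frac k2-1$; (2) for every positive divisor $d$ of $k$ and every arithmetic progression $A\subseteq\{0,1,\ldots,k-1\}$ with $\frac kd$ terms and common difference $d$, $\sum_{j\in A}f(j)\ne0$; (3) $f(j)=-1$ for $j=0,1,\ldots,\frac{a-3}{2}$. -}

module Defs where

open import Data.Nat using (ℕ; NonZero; suc; _+_; _*_; _∸_; _≤?_; _%_; _/_)
open import Data.Integer using (ℤ; +_; -_) renaming (_+_ to _+ℤ_)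
open import Data.List using (List; upTo; map; foldr)
open import Relation.Nullary.Decidable using (⌊_⌋)
open import Data.Bool using (if_then_else_)

-- The function f of the paper, for a given a > 1 odd (k = 2a), on j ∈ ℕ
-- (only used for j < k).  j % a is j mod a ∈ {0,…,a-1};
-- f j = -1 if j mod a < (a-1)/2  (i.e. suc (j mod a) ≤ (a-1)/2), else 1.
f : (a : ℕ) → .{{_ : NonZero a}} → ℕ → ℤ
f a j = if ⌊ suc (j % a) ≤? (a ∸ 1) / 2 ⌋ then - (+ 1) else + 1

sumℤ : List ℤ → ℤ
sumℤ = foldr _+ℤ_ (+ 0)

apSum : (a : ℕ) → .{{_ : NonZero a}} → (s d m : ℕ) → ℤ
apSum a s d m = sumℤ (map (λ i → f a (s + i * d)) (upTo m))

-- With a = 2b + 1, f is a-periodic and takes the value -1 on the residues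
-- 0, …, b - 1 and +1 on b, …, 2b, so on [0, 2a) it is that block of signs
-- repeated twice; this gives the counts and the initial segment of -1's.
-- A progression with step d ∣ 2a has q = 2a / d terms, each ±1, so its sum
-- has the parity of q and is nonzero when q is odd.  If q = 2e then ed = a
-- forces e to be odd, and the second half of the progression is the first
-- shifted by a, so the sum is twice a sum of e signs, again nonzero.
module Submission where

open import Defs
open import Data.Nat using (ℕ; NonZero; zero; suc; pred; _+_; _*_; _∸_; _<_; _≤_; _/_; _%_; _≤?_; z<s; s<s; ≢-nonZero)
open import Data.Nat.Properties using (+-identityʳ; +-comm; *-suc; *-comm; *-cancelˡ-≡; even≢odd; m+n∸n≡m; ∸-+-assoc; m≤pred[n]⇒suc[m]≤n; <-trans; <⇒≱; m<m+n; m≤m+n; +-monoʳ-<; *-assoc; <-irrefl)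
open import Data.Nat.DivMod using ([m+n]%n≡m%n; m<n⇒m%n≡m; m*n/n≡m; [m∸n]/n≡m/n∸1)
open import Data.Nat.Divisibility using (_∣_; quotient; divides)
open import Data.Nat.Tactic.RingSolver using (solve-∀)
open import Data.Integer using (ℤ; +_; -_; -[1+_]) renaming (_+_ to _+ℤ_)
open import Data.Integer.Properties using (_≟_; +-identityˡ; +-assoc; +-injective)
import Data.Integer.Tactic.RingSolver as ℤ-Solver
open import Data.List using (List; []; _∷_; _++_; map; filter; length; replicate; applyUpTo; upTo)
open import Data.List.Properties using (filter-++; filter-all; filter-none; length-++; length-replicate; length-applyUpTo; map-upTo)
open import Data.List.Relation.Unary.All using (All; []; _∷_)
open import Data.List.Relation.Unary.All.Properties using (replicate⁺; applyUpTo⁺₂)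
open import Data.Product using (_×_; _,_; ∃-syntax)
open import Data.Sum using (_⊎_; inj₁; inj₂)
open import Data.Bool using (if_then_else_)
open import Level using (Level; 0ℓ)
open import Function using (_∘_)
open import Relation.Binary.Definitions using (DecidableEquality)
open import Relation.Binary.PropositionalEquality using (_≡_; _≢_; refl; sym; trans; cong; cong₂; subst; subst₂; module ≡-Reasoning)
open import Relation.Nullary using (¬_; yes; no; contradiction)
open import Relation.Nullary.Decidable using (⌊_⌋; isYes≗does; dec-true; dec-false)
open import Relation.Unary using (Pred; Decidable)

open ≡-Reasoning

private variable
  ℓ : Level
  A B : Set

applyUpTo-+ : ∀ (h : ℕ → A) m n → applyUpTo h (m + n) ≡ applyUpTo h m ++ applyUpTo (λ i → h (m + i)) n
applyUpTo-+ h zero    n = refl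
applyUpTo-+ h (suc m) n = cong (h 0 ∷_) (applyUpTo-+ (h ∘ suc) m n)

applyUpTo-cong : ∀ {g h : ℕ → A} n → (∀ {i} → i < n → g i ≡ h i) → applyUpTo g n ≡ applyUpTo h n
applyUpTo-cong zero    g≗h = refl
applyUpTo-cong (suc n) g≗h = cong₂ _∷_ (g≗h z<s) (applyUpTo-cong n (g≗h ∘ s<s))

applyUpTo-const : ∀ {h : ℕ → A} {x} n → (∀ {i} → i < n → h i ≡ x) → applyUpTo h n ≡ replicate n x
applyUpTo-const zero    h≡x = refl
applyUpTo-const (suc n) h≡x = cong₂ _∷_ (h≡x z<s) (applyUpTo-const n (h≡x ∘ s<s))

applyUpTo-periodic : ∀ (h : ℕ → A) p → (∀ i → h (p + i) ≡ h i) → applyUpTo h (2 * p) ≡ applyUpTo h p ++ applyUpTo h p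
applyUpTo-periodic h p periodic = begin
  applyUpTo h (2 * p)                            ≡⟨ cong (λ n → applyUpTo h (p + n)) (+-identityʳ p) ⟩
  applyUpTo h (p + p)                            ≡⟨ applyUpTo-+ h p p ⟩
  applyUpTo h p ++ applyUpTo (λ i → h (p + i)) p ≡⟨ cong (applyUpTo h p ++_) (applyUpTo-cong p (λ {i} _ → periodic i)) ⟩
  applyUpTo h p ++ applyUpTo h p                 ∎

length-filter-++ : ∀ {P : Pred A ℓ} (P? : Decidable P) xs ys →
  length (filter P? (xs ++ ys)) ≡ length (filter P? xs) + length (filter P? ys)
length-filter-++ P? xs ys = trans (cong length (filter-++ P? xs ys)) (length-++ (filter P? xs))

length-filter-map : ∀ {P : Pred B ℓ} (P? : Decidable P) (g : A → B) xs →
  length (filter (P? ∘ g) xs) ≡ length (filter P? (map g xs))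
length-filter-map P? g []       = refl
length-filter-map P? g (x ∷ xs) with P? (g x)
... | yes _ = cong suc (length-filter-map P? g xs)
... | no _  = length-filter-map P? g xs

module _ (_≟ᴬ_ : DecidableEquality A) where

  count-replicate-self : ∀ n x → length (filter (_≟ᴬ x) (replicate n x)) ≡ n
  count-replicate-self n x = trans (cong length (filter-all (_≟ᴬ x) (replicate⁺ n refl))) (length-replicate n)

  count-replicate-other : ∀ n x y → y ≢ x → length (filter (_≟ᴬ x) (replicate n y)) ≡ 0
  count-replicate-other n x y y≢x = cong length (filter-none (_≟ᴬ x) (replicate⁺ n y≢x))

Sign : Pred ℤ 0ℓ
Sign x = x ≡ + 1 ⊎ x ≡ - (+ 1)

sumℤ-++ : ∀ xs ys → sumℤ (xs ++ ys) ≡ sumℤ xs +ℤ sumℤ ys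
sumℤ-++ []       ys = sym (+-identityˡ (sumℤ ys))
sumℤ-++ (x ∷ xs) ys = trans (cong (x +ℤ_) (sumℤ-++ xs ys)) (sym (+-assoc x (sumℤ xs) (sumℤ ys)))

-- Each +1 contributes 2 and each -1 contributes 0 to the left-hand side.
sumℤ+length-even : ∀ {xs} → All Sign xs → ∃[ p ] sumℤ xs +ℤ + length xs ≡ + (2 * p)
sumℤ+length-even [] = 0 , refl
sumℤ+length-even {_ ∷ xs} (inj₁ refl ∷ signs) with sumℤ+length-even signs
... | p , even = suc p , (begin
  (+ 1 +ℤ sumℤ xs) +ℤ (+ 1 +ℤ + length xs) ≡⟨ regroup (sumℤ xs) (+ length xs) ⟩
  (sumℤ xs +ℤ + length xs) +ℤ + 2           ≡⟨ cong (_+ℤ + 2) even ⟩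
  + (2 * p + 2)                              ≡⟨ cong +_ (trans (+-comm (2 * p) 2) (sym (*-suc 2 p))) ⟩
  + (2 * suc p)                              ∎)
  where
  regroup : ∀ s l → (+ 1 +ℤ s) +ℤ (+ 1 +ℤ l) ≡ (s +ℤ l) +ℤ + 2
  regroup = ℤ-Solver.solve-∀
sumℤ+length-even {_ ∷ xs} (inj₂ refl ∷ signs) with sumℤ+length-even signs
... | p , even = p , trans (cancel (sumℤ xs) (+ length xs)) even
  where
  cancel : ∀ s l → (- (+ 1) +ℤ s) +ℤ (+ 1 +ℤ l) ≡ s +ℤ l
  cancel = ℤ-Solver.solve-∀

sumℤ-odd-signs≢0 : ∀ {xs} e → All Sign xs → length xs ≡ suc (2 * e) → sumℤ xs ≢ + 0
sumℤ-odd-signs≢0 {xs} e signs odd sum≡0 with sumℤ+length-even signs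
... | p , even = even≢odd p e (+-injective (begin
  + (2 * p)                ≡⟨ sym even ⟩
  sumℤ xs +ℤ + length xs   ≡⟨ cong₂ _+ℤ_ sum≡0 (cong +_ odd) ⟩
  + suc (2 * e)            ∎))

x+x≡0⇒x≡0 : ∀ x → x +ℤ x ≡ + 0 → x ≡ + 0
x+x≡0⇒x≡0 (+ zero)  _ = refl
x+x≡0⇒x≡0 (+ suc _) ()
x+x≡0⇒x≡0 -[1+ _ ]  ()

even-or-odd : ∀ n → ∃[ e ] (n ≡ 2 * e ⊎ n ≡ suc (2 * e))
even-or-odd zero = 0 , inj₁ refl
even-or-odd (suc n) with even-or-odd n
... | e , inj₁ refl = e , inj₂ refl
... | e , inj₂ refl = suc e , inj₁ (sym (*-suc 2 e))

2*n/2≡n : ∀ n → 2 * n / 2 ≡ n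
2*n/2≡n n = trans (cong (_/ 2) (*-comm 2 n)) (m*n/n≡m n 2)

module _ (a : ℕ) .{{_ : NonZero a}} where

  f-< : ∀ {j} → j % a < (a ∸ 1) / 2 → f a j ≡ - (+ 1)
  f-< {j} lt = cong (if_then - (+ 1) else + 1) (trans (isYes≗does threshold?) (dec-true threshold? lt))
    where threshold? = suc (j % a) ≤? (a ∸ 1) / 2

  f-≮ : ∀ {j} → ¬ j % a < (a ∸ 1) / 2 → f a j ≡ + 1
  f-≮ {j} ≮ = cong (if_then - (+ 1) else + 1) (trans (isYes≗does threshold?) (dec-false threshold? ≮))
    where threshold? = suc (j % a) ≤? (a ∸ 1) / 2

  f-sign : ∀ j → Sign (f a j)
  f-sign j with suc (j % a) ≤? (a ∸ 1) / 2
  ... | yes _ = inj₂ refl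
  ... | no _  = inj₁ refl

  f-periodic : ∀ j → f a (a + j) ≡ f a j
  f-periodic j = cong (λ r → if ⌊ suc r ≤? (a ∸ 1) / 2 ⌋ then - (+ 1) else + 1)
    (trans (cong (_% a) (+-comm a j)) ([m+n]%n≡m%n j a))

  progression : ℕ → ℕ → ℕ → List ℤ
  progression s d m = applyUpTo (λ i → f a (s + i * d)) m

  apSum≡sum-progression : ∀ s d m → apSum a s d m ≡ sumℤ (progression s d m)
  apSum≡sum-progression s d m = cong sumℤ (map-upTo (λ i → f a (s + i * d)) m)

  progression-signs : ∀ s d m → All Sign (progression s d m)
  progression-signs s d m = applyUpTo⁺₂ (λ i → f a (s + i * d)) m (λ i → f-sign (s + i * d))

  sum-progression-odd≢0 : ∀ s d e → sumℤ (progression s d (suc (2 * e))) ≢ + 0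
  sum-progression-odd≢0 s d e = sumℤ-odd-signs≢0 e (progression-signs s d (suc (2 * e)))
    (length-applyUpTo (λ i → f a (s + i * d)) (suc (2 * e)))

  sum-progression-periodic : ∀ s d e → e * d ≡ a →
    sumℤ (progression s d (2 * e)) ≡ sumℤ (progression s d e) +ℤ sumℤ (progression s d e)
  sum-progression-periodic s d e ed≡a =
    trans (cong sumℤ (applyUpTo-periodic g e shift)) (sumℤ-++ (applyUpTo g e) (applyUpTo g e))
    where
    g : ℕ → ℤ
    g i = f a (s + i * d)

    regroup : ∀ s e i d → s + (e + i) * d ≡ e * d + (s + i * d)
    regroup = solve-∀

    shift : ∀ i → g (e + i) ≡ g i
    shift i = begin
      g (e + i)                   ≡⟨ cong (f a) (regroup s e i d) ⟩
      f a (e * d + (s + i * d))   ≡⟨ cong (λ n → f a (n + (s + i * d))) ed≡a ⟩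
      f a (a + (s + i * d))       ≡⟨ f-periodic (s + i * d) ⟩
      g i                         ∎

module OddPeriod (a b : ℕ) .{{_ : NonZero a}} (a≡2b+1 : a ≡ 2 * b + 1) where

  threshold≡b : (a ∸ 1) / 2 ≡ b
  threshold≡b = begin
    (a ∸ 1) / 2         ≡⟨ cong (λ n → (n ∸ 1) / 2) a≡2b+1 ⟩
    (2 * b + 1 ∸ 1) / 2 ≡⟨ cong (_/ 2) (m+n∸n≡m (2 * b) 1) ⟩
    2 * b / 2           ≡⟨ 2*n/2≡n b ⟩
    b                   ∎

  a≡b+[1+b] : a ≡ b + suc b
  a≡b+[1+b] = trans a≡2b+1 (regroup b)
    where
    regroup : ∀ b → 2 * b + 1 ≡ b + suc b
    regroup = solve-∀

  a-odd : ∀ m → a ≢ 2 * m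
  a-odd m a≡2m = even≢odd m b (trans (sym a≡2m) (trans a≡2b+1 (+-comm (2 * b) 1)))

  b<a : b < a
  b<a = subst (b <_) (sym a≡b+[1+b]) (m<m+n b z<s)

  f-neg : ∀ {j} → j < b → f a j ≡ - (+ 1)
  f-neg {j} j<b = f-< a (subst₂ _<_ (sym (m<n⇒m%n≡m (<-trans j<b b<a))) (sym threshold≡b) j<b)

  f-pos : ∀ {j} → b ≤ j → j < a → f a j ≡ + 1
  f-pos b≤j j<a = f-≮ a (λ lt → <⇒≱ (subst₂ _<_ (m<n⇒m%n≡m j<a) threshold≡b lt) b≤j)

  period : List ℤ
  period = replicate b (- (+ 1)) ++ replicate (suc b) (+ 1)

  applyUpTo-f≡period : applyUpTo (f a) a ≡ period
  applyUpTo-f≡period = begin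
    applyUpTo (f a) a                                            ≡⟨ cong (applyUpTo (f a)) a≡b+[1+b] ⟩
    applyUpTo (f a) (b + suc b)                                  ≡⟨ applyUpTo-+ (f a) b (suc b) ⟩
    applyUpTo (f a) b ++ applyUpTo (λ i → f a (b + i)) (suc b)   ≡⟨ cong₂ _++_ (applyUpTo-const b f-neg)
                                                                      (applyUpTo-const (suc b) (λ i<1+b → f-pos (m≤m+n b _) (b+i<a i<1+b))) ⟩
    period                                                       ∎
    where
    b+i<a : ∀ {i} → i < suc b → b + i < a
    b+i<a {i} i<1+b = subst (b + i <_) (sym a≡b+[1+b]) (+-monoʳ-< b i<1+b)

  map-f-upTo-2a : map (f a) (upTo (2 * a)) ≡ period ++ period
  map-f-upTo-2a = begin
    map (f a) (upTo (2 * a))             ≡⟨ map-upTo (f a) (2 * a) ⟩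
    applyUpTo (f a) (2 * a)              ≡⟨ applyUpTo-periodic (f a) a (f-periodic a) ⟩
    applyUpTo (f a) a ++ applyUpTo (f a) a ≡⟨ cong₂ _++_ applyUpTo-f≡period applyUpTo-f≡period ⟩
    period ++ period                     ∎

  count-upTo-2a : ∀ z → length (filter (λ j → f a j ≟ z) (upTo (2 * a))) ≡
                        length (filter (_≟ z) period) + length (filter (_≟ z) period)
  count-upTo-2a z = begin
    length (filter (λ j → f a j ≟ z) (upTo (2 * a)))  ≡⟨ length-filter-map (_≟ z) (f a) (upTo (2 * a)) ⟩
    length (filter (_≟ z) (map (f a) (upTo (2 * a)))) ≡⟨ cong (length ∘ filter (_≟ z)) map-f-upTo-2a ⟩
    length (filter (_≟ z) (period ++ period))         ≡⟨ length-filter-++ (_≟ z) period period ⟩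
    length (filter (_≟ z) period) + length (filter (_≟ z) period) ∎

  count-period-+1 : length (filter (_≟ + 1) period) ≡ suc b
  count-period-+1 = begin
    length (filter (_≟ + 1) period) ≡⟨ length-filter-++ (_≟ + 1) (replicate b (- (+ 1))) _ ⟩
    length (filter (_≟ + 1) (replicate b (- (+ 1)))) + length (filter (_≟ + 1) (replicate (suc b) (+ 1)))
      ≡⟨ cong₂ _+_ (count-replicate-other _≟_ b (+ 1) (- (+ 1)) (λ ())) (count-replicate-self _≟_ (suc b) (+ 1)) ⟩
    suc b ∎

  count-period--1 : length (filter (_≟ - (+ 1)) period) ≡ b
  count-period--1 = begin
    length (filter (_≟ - (+ 1)) period) ≡⟨ length-filter-++ (_≟ - (+ 1)) (replicate b (- (+ 1))) _ ⟩
    length (filter (_≟ - (+ 1)) (replicate b (- (+ 1)))) + length (filter (_≟ - (+ 1)) (replicate (suc b) (+ 1)))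
      ≡⟨ cong₂ _+_ (count-replicate-self _≟_ b (- (+ 1))) (count-replicate-other _≟_ (suc b) (- (+ 1)) (+ 1) (λ ())) ⟩
    b + 0 ≡⟨ +-identityʳ b ⟩
    b ∎

  count-+1 : length (filter (λ j → f a j ≟ + 1) (upTo (2 * a))) ≡ (2 * a) / 2 + 1
  count-+1 = begin
    length (filter (λ j → f a j ≟ + 1) (upTo (2 * a))) ≡⟨ count-upTo-2a (+ 1) ⟩
    length (filter (_≟ + 1) period) + length (filter (_≟ + 1) period)
                                 ≡⟨ cong₂ _+_ count-period-+1 count-period-+1 ⟩
    suc b + suc b                ≡⟨ regroup b ⟩
    2 * b + 1 + 1                ≡⟨ cong (_+ 1) (trans (sym a≡2b+1) (sym (2*n/2≡n a))) ⟩
    (2 * a) / 2 + 1              ∎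
    where
    regroup : ∀ b → suc b + suc b ≡ 2 * b + 1 + 1
    regroup = solve-∀

  count--1 : length (filter (λ j → f a j ≟ - (+ 1)) (upTo (2 * a))) + 1 ≡ (2 * a) / 2
  count--1 = begin
    length (filter (λ j → f a j ≟ - (+ 1)) (upTo (2 * a))) + 1 ≡⟨ cong (_+ 1) (count-upTo-2a (- (+ 1))) ⟩
    length (filter (_≟ - (+ 1)) period) + length (filter (_≟ - (+ 1)) period) + 1
                                 ≡⟨ cong (λ n → n + n + 1) count-period--1 ⟩
    b + b + 1                    ≡⟨ regroup b ⟩
    2 * b + 1                    ≡⟨ trans (sym a≡2b+1) (sym (2*n/2≡n a)) ⟩
    (2 * a) / 2                  ∎
    where
    regroup : ∀ b → b + b + 1 ≡ 2 * b + 1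
    regroup = solve-∀

  apSum≢0 : ∀ d s (d∣2a : d ∣ 2 * a) → apSum a s d (quotient d∣2a) ≢ + 0
  apSum≢0 d s (divides q 2a≡qd) = sum≢0 q 2a≡qd ∘ trans (sym (apSum≡sum-progression a s d q))
    where
    sum-2e≢0 : ∀ e → a ≡ e * d → sumℤ (progression a s d (2 * e)) ≢ + 0
    sum-2e≢0 e a≡ed with even-or-odd e
    ... | t , inj₁ refl = contradiction (trans a≡ed (*-assoc 2 t d)) (a-odd (t * d))
    ... | t , inj₂ refl = sum-progression-odd≢0 a s d t ∘ x+x≡0⇒x≡0 _
                          ∘ trans (sym (sum-progression-periodic a s d e (sym a≡ed)))

    sum≢0 : ∀ q → 2 * a ≡ q * d → sumℤ (progression a s d q) ≢ + 0
    sum≢0 q 2a≡qd with even-or-odd q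
    ... | e , inj₁ refl = sum-2e≢0 e (*-cancelˡ-≡ a (e * d) 2 (trans 2a≡qd (*-assoc 2 e d)))
    ... | e , inj₂ refl = sum-progression-odd≢0 a s d e

  [a∸3]/2≡pred[b] : (a ∸ 3) / 2 ≡ pred b
  [a∸3]/2≡pred[b] = begin
    (a ∸ 3) / 2        ≡⟨ cong (_/ 2) (∸-+-assoc a 1 2) ⟨
    (a ∸ 1 ∸ 2) / 2    ≡⟨ [m∸n]/n≡m/n∸1 (a ∸ 1) 2 ⟩
    pred ((a ∸ 1) / 2) ≡⟨ cong pred threshold≡b ⟩
    pred b             ∎

  1<a⇒b≢0 : 1 < a → b ≢ 0
  1<a⇒b≢0 1<a b≡0 = <-irrefl refl (subst (1 <_) (trans a≡2b+1 (cong (λ n → 2 * n + 1) b≡0)) 1<a)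

  f-initial : 1 < a → ∀ j → j ≤ (a ∸ 3) / 2 → f a j ≡ - (+ 1)
  f-initial 1<a j j≤ =
    f-neg (m≤pred[n]⇒suc[m]≤n {{≢-nonZero (1<a⇒b≢0 1<a)}} (subst (j ≤_) [a∸3]/2≡pred[b] j≤))

corollary3p3 : (a : ℕ) → .{{_ : NonZero a}} → 1 < a → ∃[ b ] a ≡ 2 * b + 1 →
    (length (filter (λ j → f a j ≟ + 1) (upTo (2 * a))) ≡ (2 * a) / 2 + 1
      × length (filter (λ j → f a j ≟ - (+ 1)) (upTo (2 * a))) + 1 ≡ (2 * a) / 2)
    × (∀ d s → 0 < d → (p : d ∣ 2 * a) → s + (quotient p ∸ 1) * d < 2 * a →
        apSum a s d (quotient p) ≢ + 0)
    × (∀ j → j ≤ (a ∸ 3) / 2 → f a j ≡ - (+ 1))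
corollary3p3 a 1<a (b , a≡2b+1) =
  (count-+1 , count--1) , (λ d s _ d∣2a _ → apSum≢0 d s d∣2a) , f-initial 1<a
  where open OddPeriod a b a≡2b+1
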